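{- Each of $k=1,2,4$ is forcing for $\mathcal{T}$. On the other hand, $k=3$ is weakly forcing for $\mathcal{T}$ with $f_{\mathcal{T}}(3)=0$. Nevertheless, for every positive integer $\Delta$, $k=3$ is forcing for $\mathcal{T}_\Delta$.
   Context: For a graph $G$, a weighing is a function $w: E(G) \to \{ -1,1\}$, and for a subgraph $H$, $w(H)=\sum_{e\in E(H)} w(e)$. For a positive integer $k$, $w$ is $k$-local positive if $w(H)>0$ for every connected subgraph $H$ of $G$ with exactly $k$ edges. For an infinite family $\mathcal{G}$ of connected graphs, $k$ is forcing for $\mathcal{G}$ if for all but finitely many $G \in \mathcal{G}$, every $k$-local positive weighing $w$ of $G$ satisfies $w(G)>0$. If $k$ is not forcing, $k$ is weakly forcing for $\mathcal{G}$ if there is a constant $C$ (possibly negative) such that for all but finitely many $G\in\mathcal{G}$, every $k$-local positive weighing $w$ of $G$ has $w(G)\ge C$; $f_{\mathcal{G}}(k)$ denotes the maximum such $C$. $\mathcal{T}$ is the family of all (finite) trees and $\mathcal{T}_\Delta$ the family of all trees with maximum degree at most $\Delta$. -}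

module Defs where

open import Data.Nat using (ℕ; zero; suc; _≤_)
open import Data.Integer using (ℤ; 0ℤ; 1ℤ; -1ℤ) renaming (_+_ to _+ℤ_; _<_ to _<ℤ_; _≤_ to _≤ℤ_)
open import Data.Fin using (Fin; inject₁; fromℕ) renaming (zero to fz; suc to fs)
import Data.Fin as Fin
open import Data.Bool using (Bool; true; false; if_then_else_; _∨_)
open import Data.Product using (Σ; ∃; _×_; _,_; proj₁; proj₂)
open import Data.Sum using (_⊎_)
open import Data.Empty using (⊥)
open import Relation.Nullary using (¬_)
open import Relation.Nullary.Decidable using (⌊_⌋)
open import Relation.Binary.PropositionalEquality using (_≡_; _≢_)
open import Function.Definitions using (Injective)

sumℤ : ∀ {m} → (Fin m → ℤ) → ℤ
sumℤ {zero}  f = 0ℤ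
sumℤ {suc m} f = f fz +ℤ sumℤ (λ i → f (fs i))

countB : ∀ {m} → (Fin m → Bool) → ℕ
countB {zero}  f = 0
countB {suc m} f = (if f fz then 1 else 0) Data.Nat.+ countB (λ i → f (fs i))
  where import Data.Nat

SameEnds : ∀ {n} → Fin n × Fin n → Fin n × Fin n → Set
SameEnds (a , b) (c , d) = (a ≡ c × b ≡ d) ⊎ (a ≡ d × b ≡ c)

record Graph : Set where
  field
    n     : ℕ
    m     : ℕ
    ends  : Fin m → Fin n × Fin n
    noLoop  : ∀ e → proj₁ (ends e) ≢ proj₂ (ends e)
    noMulti : ∀ e e' → SameEnds (ends e) (ends e') → e ≡ e'

open Graph public

module _ (G : Graph) where

  Joins : Fin (m G) → Fin (n G) → Fin (n G) → Set
  Joins e u v = SameEnds (ends G e) (u , v)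

  Adj : Fin (n G) → Fin (n G) → Set
  Adj u v = ∃ λ e → Joins e u v

  data Reach (S : Fin (m G) → Bool) : Fin (n G) → Fin (n G) → Set where
    here : ∀ {u} → Reach S u u
    step : ∀ {u w v} (e : Fin (m G)) → S e ≡ true → Joins e u w →
           Reach S w v → Reach S u v

  Connected : Set
  Connected = (1 ≤ n G) × (∀ u v → Reach (λ _ → true) u v)

  HasCycle : Set
  HasCycle = Σ ℕ λ l → Σ (Fin (suc (suc (suc l))) → Fin (n G)) λ c →
    Injective _≡_ _≡_ c ×
    (∀ (i : Fin (suc (suc l))) → Adj (c (inject₁ i)) (c (fs i))) ×
    Adj (c (fromℕ (suc (suc l)))) (c fz)

  IsTree : Set
  IsTree = Connected × ¬ HasCycle

  degree : Fin (n G) → ℕ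
  degree v = countB (λ e → ⌊ proj₁ (ends G e) Fin.≟ v ⌋ ∨ ⌊ proj₂ (ends G e) Fin.≟ v ⌋)

  MaxDegreeAtMost : ℕ → Set
  MaxDegreeAtMost Δ = ∀ v → degree v ≤ Δ

  IsWeighing : (Fin (m G) → ℤ) → Set
  IsWeighing w = ∀ e → (w e ≡ 1ℤ) ⊎ (w e ≡ -1ℤ)

  ConnectedEdgeSet : (Fin (m G) → Bool) → Set
  ConnectedEdgeSet S = ∀ e e' → S e ≡ true → S e' ≡ true →
    Reach S (proj₁ (ends G e)) (proj₁ (ends G e'))

  weightOn : (Fin (m G) → ℤ) → (Fin (m G) → Bool) → ℤ
  weightOn w S = sumℤ (λ e → if S e then w e else 0ℤ)

  totalWeight : (Fin (m G) → ℤ) → ℤ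
  totalWeight w = sumℤ w

  LocalPositive : ℕ → (Fin (m G) → ℤ) → Set
  LocalPositive k w = ∀ (S : Fin (m G) → Bool) → countB S ≡ k →
    ConnectedEdgeSet S → 0ℤ <ℤ weightOn w S

Family : Set₁
Family = Graph → Set

𝒯 : Family
𝒯 G = IsTree G

𝒯[_] : ℕ → Family
𝒯[ Δ ] G = IsTree G × MaxDegreeAtMost G Δ

-- "for all but finitely many G ∈ 𝒢": for all G ∈ 𝒢 with at least N vertices
-- (there are only finitely many simple graphs on Fin n for each n)
AllButFinitely : Family → (Graph → Set) → Set
AllButFinitely 𝒢 P = ∃ λ N → ∀ G → 𝒢 G → N ≤ n G → P G

Forcing : Family → ℕ → Set
Forcing 𝒢 k = AllButFinitely 𝒢 λ G →
  ∀ w → IsWeighing G w → LocalPositive G k w → 0ℤ <ℤ totalWeight G w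

WeakBound : Family → ℕ → ℤ → Set
WeakBound 𝒢 k C = AllButFinitely 𝒢 λ G →
  ∀ w → IsWeighing G w → LocalPositive G k w → C ≤ℤ totalWeight G w

WeaklyForcingWithValue : Family → ℕ → ℤ → Set
WeaklyForcingWithValue 𝒢 k C =
  ¬ Forcing 𝒢 k × WeakBound 𝒢 k C × (∀ C' → C <ℤ C' → ¬ WeakBound 𝒢 k C')

module Submission where

-- The positive results only use that G is connected with n > 2k vertices.
-- Then every connected set L of ℓ ≤ k edges can be grown to a connected set
-- of k edges, so k-local positivity gives w(L) + (k - ℓ) > 0 (local-bound).
-- For k ≤ 2 this forces every edge to be positive.  For k ∈ {3, 4} it shows
-- that the neighbours of a negative edge are positive (F1), that two
-- negative edges have no common neighbour (F2), and, for k = 4, that no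
-- path of four edges has negative ends (F3).  Pairing every negative edge
-- with one of its neighbours is then an injection from negative into
-- positive edges, so w(G) ≥ 0, and w(G) > 0 unless every positive edge is a
-- partner ("saturation").  Saturation contradicts (F3) when k = 4, and when
-- k = 3 it forces G to be a spider around one vertex, hence to have at most
-- 1 + 2Δ vertices.  Finally the spider with legs of length two, weighted +1
-- on inner and -1 on outer edges, shows that f(3) = 0 cannot be improved.

open import Defs
open import Data.Nat using (ℕ; _≤_)
open import Data.Integer using (0ℤ)
open import Data.Product using (_×_)

open import Data.Nat as ℕ using (zero; suc; _+_; _∸_; _<_; z≤n; s≤s)
import Data.Nat.Properties as ℕP
open import Data.Integer as ℤ using (ℤ; +_; -[1+_]; 1ℤ; -1ℤ; _⊖_)
  renaming (_+_ to _+ℤ_; _≤_ to _≤ℤ_; _<_ to _<ℤ_)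
import Data.Integer.Properties as ℤP
open import Data.Fin as F using (Fin; toℕ; fromℕ; inject₁; lower₁; _↑ˡ_; _↑ʳ_) renaming (zero to fz; suc to fs)
import Data.Fin.Properties as FP
open import Data.Bool using (Bool; true; false; if_then_else_; _∨_; _∧_; not)
open import Data.Bool.Properties using (∧-identityʳ; ∧-zeroʳ)
open import Data.Product using (Σ; _,_; proj₁; proj₂)
open import Data.Sum using (_⊎_; inj₁; inj₂; [_,_]′)
open import Data.Empty using (⊥; ⊥-elim)
open import Relation.Nullary using (Dec; ¬_; ¬?; yes; no; does; contradiction; _×-dec_; _⊎-dec_)
open import Relation.Nullary.Decidable using (⌊_⌋; dec-true; dec-false; decidable-stable)
open import Relation.Binary.PropositionalEquality
open import Data.List using (List; []; _∷_; length; lookup)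
open import Data.Unit using (⊤; tt)
open import Data.List.Relation.Unary.Any using (here; there)
import Data.List.Relation.Unary.Any as Any
open import Data.List.Relation.Unary.Any.Properties using (lookup-index)
open import Data.List.Relation.Unary.All using ([]; _∷_)
open import Data.List.Relation.Unary.All.Properties using (All¬⇒¬Any; ¬Any⇒All¬)
open import Data.List.Relation.Unary.Unique.Propositional using (Unique; []; _∷_)
open import Data.List.Membership.Propositional using (_∈_; _∉_)
import Data.List.Membership.DecPropositional as DecMembership

_==_ : ∀ {K} → Fin K → Fin K → Bool
i == j = does (i F.≟ j)

==-refl : ∀ {K} (i : Fin K) → (i == i) ≡ true
==-refl i = dec-true (i F.≟ i) refl

countB-ext : ∀ {m} {P Q : Fin m → Bool} → (∀ i → P i ≡ Q i) → countB P ≡ countB Q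
countB-ext {zero}  P≡Q = refl
countB-ext {suc m} P≡Q rewrite P≡Q fz = cong (λ c → _ + c) (countB-ext (λ i → P≡Q (fs i)))

countB-false : ∀ {m} {P : Fin m → Bool} → (∀ i → P i ≡ false) → countB P ≡ 0
countB-false {zero}  none = refl
countB-false {suc m} none rewrite none fz = countB-false (λ i → none (fs i))

countB-true : ∀ {m} {P : Fin m → Bool} → (∀ i → P i ≡ true) → countB P ≡ m
countB-true {zero}  all = refl
countB-true {suc m} all rewrite all fz = cong suc (countB-true (λ i → all (fs i)))

countB-+ : ∀ a {b} (P : Fin (a + b) → Bool) →
  countB P ≡ countB (λ i → P (i ↑ˡ b)) + countB (λ j → P (a ↑ʳ j))
countB-+ zero    P = refl
countB-+ (suc a) P with P fz
... | true  = cong suc (countB-+ a (λ i → P (fs i)))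
... | false = countB-+ a (λ i → P (fs i))

remove : ∀ {K} → (Fin K → Bool) → Fin K → Fin K → Bool
remove B p j = B j ∧ not (j == p)

countB-remove : ∀ {K} (B : Fin K → Bool) p → B p ≡ true →
  countB B ≡ suc (countB (remove B p))
countB-remove {suc K} B fz Bp rewrite Bp =
  cong suc (countB-ext (λ i → sym (∧-identityʳ (B (fs i)))))
countB-remove {suc K} B (fs p) Bp with B fz
... | true  = cong suc (countB-remove (λ i → B (fs i)) p Bp)
... | false = countB-remove (λ i → B (fs i)) p Bp

sumOn : ∀ {K} → (Fin K → Bool) → (Fin K → ℤ) → ℤ
sumOn B w = sumℤ (λ e → if B e then w e else 0ℤ)

sumOn-empty : ∀ {K} (w : Fin K → ℤ) → sumOn (λ _ → false) w ≡ 0ℤ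
sumOn-empty {zero}  w = refl
sumOn-empty {suc K} w = trans (ℤP.+-identityˡ _) (sumOn-empty (λ i → w (fs i)))

sumOn-ext : ∀ {K} {B B′ : Fin K → Bool} (w : Fin K → ℤ) → (∀ i → B i ≡ B′ i) → sumOn B w ≡ sumOn B′ w
sumOn-ext {zero}  w B≡B′ = refl
sumOn-ext {suc K} w B≡B′ = cong₂ _+ℤ_ (cong (λ b → if b then w fz else 0ℤ) (B≡B′ fz))
                                      (sumOn-ext (λ i → w (fs i)) (λ i → B≡B′ (fs i)))

sumOn-remove : ∀ {K} (B : Fin K → Bool) (w : Fin K → ℤ) p → B p ≡ true →
  sumOn B w ≡ w p +ℤ sumOn (remove B p) w
sumOn-remove {suc K} B w fz Bp rewrite Bp =
  cong (w fz +ℤ_) (trans (sumOn-ext _ (λ i → sym (∧-identityʳ (B (fs i))))) (sym (ℤP.+-identityˡ _)))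
sumOn-remove {suc K} B w (fs p) Bp with B fz
... | true  = begin
    w fz +ℤ sumOn B′ w′                   ≡⟨ cong (w fz +ℤ_) (sumOn-remove B′ w′ p Bp) ⟩
    w fz +ℤ (w′ p +ℤ R)                   ≡⟨ ℤP.+-assoc (w fz) (w′ p) R ⟨
    (w fz +ℤ w′ p) +ℤ R                   ≡⟨ cong (_+ℤ R) (ℤP.+-comm (w fz) (w′ p)) ⟩
    (w′ p +ℤ w fz) +ℤ R                   ≡⟨ ℤP.+-assoc (w′ p) (w fz) R ⟩
    w′ p +ℤ (w fz +ℤ R)                   ∎
  where
  open ≡-Reasoning
  B′ : Fin K → Bool
  B′ i = B (fs i)
  w′ : Fin K → ℤ
  w′ i = w (fs i)
  R : ℤ
  R = sumOn (remove B′ p) w′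
... | false = trans (ℤP.+-identityˡ _) (trans (sumOn-remove (λ i → B (fs i)) (λ i → w (fs i)) p Bp)
                (cong (w (fs p) +ℤ_) (sym (ℤP.+-identityˡ _))))

countB-inj : ∀ {n K} (A : Fin n → Bool) (B : Fin K → Bool) (φ : Fin n → Fin K) →
  (∀ e → A e ≡ true → B (φ e) ≡ true) →
  (∀ e f → A e ≡ true → A f ≡ true → φ e ≡ φ f → e ≡ f) →
  countB A ≤ countB B
countB-inj {zero}  A B φ into inj = z≤n
countB-inj {suc n} A B φ into inj with A fz in A0
... | false = countB-inj (λ i → A (fs i)) B (λ i → φ (fs i)) (λ e → into (fs e))
                (λ e f a b eq → FP.suc-injective (inj _ _ a b eq))
... | true  = subst (suc (countB (λ i → A (fs i))) ≤_) (sym (countB-remove B (φ fz) (into fz A0)))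
                (s≤s (countB-inj (λ i → A (fs i)) (remove B (φ fz)) (λ i → φ (fs i)) into′
                   (λ e f a b eq → FP.suc-injective (inj _ _ a b eq))))
  where
  into′ : ∀ e → A (fs e) ≡ true → remove B (φ fz) (φ (fs e)) ≡ true
  into′ e a = cong₂ _∧_ (into (fs e) a)
                (cong not (dec-false (φ (fs e) F.≟ φ fz) (λ eq → 0≢1+n (inj _ _ A0 a (sym eq)))))
    where 0≢1+n : fz ≢ fs e
          0≢1+n ()

countB-inj-strict : ∀ {n K} (A : Fin n → Bool) (B : Fin K → Bool) (φ : Fin n → Fin K) (h : Fin K) →
  (∀ e → A e ≡ true → B (φ e) ≡ true) →
  (∀ e f → A e ≡ true → A f ≡ true → φ e ≡ φ f → e ≡ f) →
  B h ≡ true → (∀ e → A e ≡ true → φ e ≢ h) →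
  countB A < countB B
countB-inj-strict A B φ h into inj Bh missed =
  subst (suc (countB A) ≤_) (sym (countB-remove B h Bh))
    (s≤s (countB-inj A (remove B h) φ
      (λ e a → cong₂ _∧_ (into e a) (cong not (dec-false (φ e F.≟ h) (missed e a)))) inj))

one-witness : ∀ {K} (P : Fin K → Bool) → 1 ≤ countB P → Σ (Fin K) λ i → P i ≡ true
one-witness {suc K} P le with P fz in P0
... | true  = fz , P0
... | false with one-witness (λ i → P (fs i)) le
... | i , Pi = fs i , Pi

two-witnesses : ∀ {K} (P : Fin K → Bool) → 2 ≤ countB P →
  Σ (Fin K) λ i → Σ (Fin K) λ j → (i ≢ j) × (P i ≡ true) × (P j ≡ true)
two-witnesses {suc K} P le with P fz in P0
... | true with one-witness (λ i → P (fs i)) (ℕ.s≤s⁻¹ le)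
... | j , Pj = fz , fs j , (λ ()) , P0 , Pj
two-witnesses {suc K} P le | false with two-witnesses (λ i → P (fs i)) le
... | i , j , i≢j , Pi , Pj = fs i , fs j , (λ eq → i≢j (FP.suc-injective eq)) , Pi , Pj

isNeg : ℤ → Bool
isNeg (+ _)    = false
isNeg -[1+ _ ] = true

isPos : ℤ → Bool
isPos z = not (isNeg z)

Signs : ∀ {m} → (Fin m → ℤ) → Set
Signs w = ∀ e → (w e ≡ 1ℤ) ⊎ (w e ≡ -1ℤ)

sum-signs : ∀ {m} (w : Fin m → ℤ) → Signs w →
  sumℤ w ≡ countB (λ e → isPos (w e)) ⊖ countB (λ e → isNeg (w e))
sum-signs {zero}  w ±1 = refl
sum-signs {suc m} w ±1 with ±1 fz
... | inj₁ w0 rewrite w0 = trans (cong (1ℤ +ℤ_) (sum-signs _ (λ i → ±1 (fs i))))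
                                 (ℤP.distribʳ-⊖-+-pos 1 Pos Neg)
  where
  Pos Neg : ℕ
  Pos = countB (λ e → isPos (w (fs e)))
  Neg = countB (λ e → isNeg (w (fs e)))
... | inj₂ w0 rewrite w0 = trans (cong (-1ℤ +ℤ_) (sum-signs _ (λ i → ±1 (fs i))))
                                 (ℤP.distribʳ-⊖-+-neg 0 Pos Neg)
  where
  Pos Neg : ℕ
  Pos = countB (λ e → isPos (w (fs e)))
  Neg = countB (λ e → isNeg (w (fs e)))

restricted-sum : ∀ {m} (S : Fin m → Bool) (w : Fin m → ℤ) → Signs w →
  sumOn S w ≡
  countB S ⊖ (countB (λ e → S e ∧ isNeg (w e)) + countB (λ e → S e ∧ isNeg (w e)))
restricted-sum {zero}  S w ±1 = refl
restricted-sum {suc m} S w ±1 with S fz | ±1 fz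
... | false | _ = trans (ℤP.+-identityˡ _) (restricted-sum _ _ (λ i → ±1 (fs i)))
... | true | inj₁ w0 rewrite w0 =
  trans (cong (1ℤ +ℤ_) (restricted-sum _ _ (λ i → ±1 (fs i)))) (ℤP.distribʳ-⊖-+-pos 1 C (X + X))
  where
  C X : ℕ
  C = countB (λ i → S (fs i))
  X = countB (λ i → S (fs i) ∧ isNeg (w (fs i)))
... | true | inj₂ w0 rewrite w0 =
  begin
    -1ℤ +ℤ sumOn (λ i → S (fs i)) (λ i → w (fs i))
      ≡⟨ cong (-1ℤ +ℤ_) (restricted-sum _ _ (λ i → ±1 (fs i))) ⟩
    -1ℤ +ℤ (C ⊖ (X + X))        ≡⟨ ℤP.distribʳ-⊖-+-neg 0 C (X + X) ⟩
    C ⊖ suc (X + X)             ≡⟨ ℤP.[1+m]⊖[1+n]≡m⊖n C (suc (X + X)) ⟨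
    suc C ⊖ suc (suc (X + X))   ≡⟨ cong (λ y → suc C ⊖ suc y) (ℕP.+-suc X X) ⟨
    suc C ⊖ (suc X + suc X)     ∎
  where
  open ≡-Reasoning
  C X : ℕ
  C = countB (λ i → S (fs i))
  X = countB (λ i → S (fs i) ∧ isNeg (w (fs i)))

⊖-positive : ∀ {a b} → b < a → 0ℤ <ℤ a ⊖ b
⊖-positive b<a rewrite ℤP.⊖-≥ (ℕP.<⇒≤ b<a) = ℤ.+<+ (ℕP.m<n⇒0<n∸m b<a)

⊖-nonnegative : ∀ {a b} → b ≤ a → 0ℤ ≤ℤ a ⊖ b
⊖-nonnegative b≤a rewrite ℤP.⊖-≥ b≤a = ℤ.+≤+ z≤n

-- A list with fewer than n entries misses some element of Fin n
-- (the position of an element in the list would be an injection Fin n → Fin length).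
missed : ∀ {n} (vs : List (Fin n)) → length vs < n → Σ (Fin n) λ v → v ∉ vs
missed {n} vs short = FP.¬∀⟶∃¬ n (_∈ vs) (λ v → DecMembership._∈?_ F._≟_ v vs)
  (λ covered → ℕP.<⇒≱ short (FP.injective⇒≤ (position-injective covered)))
  where
  position-injective : (covered : ∀ v → v ∈ vs) → ∀ {u v} →
    Any.index (covered u) ≡ Any.index (covered v) → u ≡ v
  position-injective covered {u} {v} eq =
    trans (lookup-index (covered u)) (trans (cong (lookup vs) eq) (sym (lookup-index (covered v))))

module Basics (G : Graph) where

  V : Set
  V = Fin (n G)

  E : Set
  E = Fin (m G)

  end₁ end₂ : E → V
  end₁ e = proj₁ (ends G e)
  end₂ e = proj₂ (ends G e)

  Inc : E → V → Set
  Inc e v = (end₁ e ≡ v) ⊎ (end₂ e ≡ v)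

  Share : E → E → Set
  Share e f = Σ V λ v → Inc e v × Inc f v

  share-sym : ∀ {e f} → Share e f → Share f e
  share-sym (v , e∋v , f∋v) = v , f∋v , e∋v

  joins-sym : ∀ {e u v} → Joins G e u v → Joins G e v u
  joins-sym (inj₁ (p , q)) = inj₂ (p , q)
  joins-sym (inj₂ (p , q)) = inj₁ (p , q)

  joins-inc₁ : ∀ {e u v} → Joins G e u v → Inc e u
  joins-inc₁ (inj₁ (p , _)) = inj₁ p
  joins-inc₁ (inj₂ (_ , q)) = inj₂ q

  joins-inc₂ : ∀ {e u v} → Joins G e u v → Inc e v
  joins-inc₂ (inj₁ (_ , q)) = inj₂ q
  joins-inc₂ (inj₂ (p , _)) = inj₁ p

  reach-trans : ∀ {S u v x} → Reach G S u v → Reach G S v x → Reach G S u x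
  reach-trans here           q = q
  reach-trans (step e s j r) q = step e s j (reach-trans r q)

  reach-sym : ∀ {S u v} → Reach G S u v → Reach G S v u
  reach-sym here           = here
  reach-sym (step e s j r) = reach-trans (reach-sym r) (step e s (joins-sym j) here)

  reach-mono : ∀ {S S′} → (∀ e → S e ≡ true → S′ e ≡ true) →
               ∀ {u v} → Reach G S u v → Reach G S′ u v
  reach-mono S⊆S′ here           = here
  reach-mono S⊆S′ (step e s j r) = step e (S⊆S′ e s) j (reach-mono S⊆S′ r)

  reach-inc : ∀ {S} e {v} → S e ≡ true → Inc e v → Reach G S (end₁ e) v
  reach-inc e s (inj₁ refl) = here
  reach-inc e s (inj₂ refl) = step e s (inj₁ (refl , refl)) here

  reach-share : ∀ {S} e f → S e ≡ true → S f ≡ true → Share e f → Reach G S (end₁ e) (end₁ f)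
  reach-share e f se sf (v , e∋v , f∋v) = reach-trans (reach-inc e se e∋v) (reach-sym (reach-inc f sf f∋v))

  open DecMembership (F._≟_ {m G}) public using (_∈?_)

  ⟦_⟧ : List E → E → Bool
  ⟦ L ⟧ e = does (e ∈? L)

  ∈⇒⟦⟧ : ∀ {e L} → e ∈ L → ⟦ L ⟧ e ≡ true
  ∈⇒⟦⟧ {e} {L} = dec-true (e ∈? L)

  ⟦⟧⇒∈ : ∀ {e} L → ⟦ L ⟧ e ≡ true → e ∈ L
  ⟦⟧⇒∈ {e} L p with e ∈? L | p
  ... | yes e∈L | _ = e∈L
  ... | no  _   | ()

  ⟦⟧-cons : ∀ x L e → ⟦ L ⟧ e ≡ true → ⟦ x ∷ L ⟧ e ≡ true
  ⟦⟧-cons x L e p = ∈⇒⟦⟧ {e} {x ∷ L} (there (⟦⟧⇒∈ L p))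

  remove-head : ∀ {x xs} → x ∉ xs → ∀ e → remove ⟦ x ∷ xs ⟧ x e ≡ ⟦ xs ⟧ e
  remove-head {x} {xs} x∉xs e with e F.≟ x
  ... | yes refl = sym (dec-false (e ∈? xs) x∉xs)
  ... | no  _    = ∧-identityʳ _

  count-list : ∀ {L} → Unique L → countB ⟦ L ⟧ ≡ length L
  count-list []                   = countB-false {P = ⟦ [] ⟧} (λ _ → refl)
  count-list {x ∷ xs} (x∉ ∷ uniq) =
    trans (countB-remove ⟦ x ∷ xs ⟧ x (∈⇒⟦⟧ {x} {x ∷ xs} (here refl)))
          (cong suc (trans (countB-ext (remove-head (All¬⇒¬Any x∉))) (count-list uniq)))

  listWeight : (E → ℤ) → List E → ℤ
  listWeight w []       = 0ℤ
  listWeight w (x ∷ xs) = w x +ℤ listWeight w xs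

  weight-list : ∀ w {L} → Unique L → weightOn G w ⟦ L ⟧ ≡ listWeight w L
  weight-list w []                   = sumOn-empty w
  weight-list w {x ∷ xs} (x∉ ∷ uniq) =
    trans (sumOn-remove ⟦ x ∷ xs ⟧ w x (∈⇒⟦⟧ {x} {x ∷ xs} (here refl)))
          (cong (w x +ℤ_) (trans (sumOn-ext w (remove-head (All¬⇒¬Any x∉))) (weight-list w uniq)))

  Rooted : List E → V → Set
  Rooted L r = ∀ {e} → e ∈ L → Reach G ⟦ L ⟧ (end₁ e) r

  rooted-connected : ∀ {L r} → Rooted L r → ConnectedEdgeSet G ⟦ L ⟧
  rooted-connected {L} root e e′ e∈ e′∈ = reach-trans (root (⟦⟧⇒∈ L e∈)) (reach-sym (root (⟦⟧⇒∈ L e′∈)))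

  rooted-grow : ∀ {L r e f} → Rooted L r → e ∈ L → Share e f → Rooted (f ∷ L) r
  rooted-grow {L} {r} {e} {f} root e∈L e~f (here refl) =
    reach-trans (reach-share f e (∈⇒⟦⟧ {f} {f ∷ L} (here refl)) (∈⇒⟦⟧ {e} {f ∷ L} (there e∈L)) (share-sym e~f))
                (reach-mono (⟦⟧-cons f L) (root e∈L))
  rooted-grow {L} {f = f} root e∈L e~f (there g∈L) = reach-mono (⟦⟧-cons f L) (root g∈L)

  Chain : List E → Set
  Chain (x ∷ y ∷ ys) = Share x y × Chain (y ∷ ys)
  Chain _            = ⊤

  chain-rooted : ∀ x xs → Chain (x ∷ xs) → Rooted (x ∷ xs) (end₁ x)
  chain-rooted x xs       _               (here refl) = here
  chain-rooted x (y ∷ ys) (x~y , chain)   (there e∈)  =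
    reach-trans (reach-mono (⟦⟧-cons x (y ∷ ys)) (chain-rooted y ys chain e∈))
                (reach-share y x (∈⇒⟦⟧ {y} {x ∷ y ∷ ys} (there (here refl))) (∈⇒⟦⟧ {x} {x ∷ y ∷ ys} (here refl))
                             (share-sym x~y))

  other : E → V → V
  other h t = if end₁ h == t then end₂ h else end₁ h

  joins-other : ∀ {h a b} → Joins G h a b → b ≡ other h a
  joins-other {h} (inj₁ (refl , refl)) rewrite ==-refl (end₁ h) = refl
  joins-other {h} (inj₂ (refl , refl)) rewrite dec-false (end₁ h F.≟ end₂ h) (noLoop G h) = refl

  inc-joins-other : ∀ {h t} → Inc h t → Joins G h t (other h t)
  inc-joins-other {h} (inj₁ refl) rewrite ==-refl (end₁ h) = inj₁ (refl , refl)
  inc-joins-other {h} (inj₂ refl) rewrite dec-false (end₁ h F.≟ end₂ h) (noLoop G h) = inj₂ (refl , refl)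

  inc-other : ∀ {h t} → Inc h t → Inc h (other h t)
  inc-other h∋t = joins-inc₂ (inc-joins-other h∋t)

  other-other : ∀ {h t} → Inc h t → other h (other h t) ≡ t
  other-other h∋t = sym (joins-other (joins-sym (inc-joins-other h∋t)))

  other-≢ : ∀ {h t} → Inc h t → other h t ≢ t
  other-≢ {h} (inj₁ refl) eq rewrite ==-refl (end₁ h) = noLoop G h (sym eq)
  other-≢ {h} (inj₂ refl) eq rewrite dec-false (end₁ h F.≟ end₂ h) (noLoop G h) = noLoop G h eq

  inc-two : ∀ {h s t} → Inc h t → Inc h s → (s ≡ t) ⊎ (s ≡ other h t)
  inc-two {h} {s} {t} h∋t h∋s with inc-joins-other h∋t | h∋s
  ... | inj₁ (p , q) | inj₁ r = inj₁ (trans (sym r) p)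
  ... | inj₁ (p , q) | inj₂ r = inj₂ (trans (sym r) q)
  ... | inj₂ (p , q) | inj₁ r = inj₂ (trans (sym r) p)
  ... | inj₂ (p , q) | inj₂ r = inj₁ (trans (sym r) q)

  same-ends : ∀ {a b s t} → Inc a s → Inc a t → Inc b s → Inc b t → s ≢ t → a ≡ b
  same-ends {a} {b} {s} {t} a∋s a∋t b∋s b∋t s≢t with inc-two a∋s a∋t | inc-two b∋s b∋t
  ... | inj₁ t≡s  | _         = ⊥-elim (s≢t (sym t≡s))
  ... | inj₂ _    | inj₁ t≡s  = ⊥-elim (s≢t (sym t≡s))
  ... | inj₂ t≡oa | inj₂ t≡ob = noMulti G a b (same (inc-joins-other a∋s) (inc-joins-other b∋s))
    where
    same : Joins G a s (other a s) → Joins G b s (other b s) → SameEnds (ends G a) (ends G b)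
    same ja jb rewrite sym t≡oa | sym t≡ob with ja | jb
    ... | inj₁ (p , q) | inj₁ (p′ , q′) = inj₁ (trans p (sym p′) , trans q (sym q′))
    ... | inj₁ (p , q) | inj₂ (p′ , q′) = inj₂ (trans p (sym q′) , trans q (sym p′))
    ... | inj₂ (p , q) | inj₁ (p′ , q′) = inj₂ (trans p (sym q′) , trans q (sym p′))
    ... | inj₂ (p , q) | inj₂ (p′ , q′) = inj₁ (trans p (sym p′) , trans q (sym q′))

  incident? : E → V → Bool
  incident? h t = ⌊ end₁ h F.≟ t ⌋ ∨ ⌊ end₂ h F.≟ t ⌋

  incident?-complete : ∀ {h t} → Inc h t → incident? h t ≡ true
  incident?-complete {h} {t} h∋t with end₁ h F.≟ t | end₂ h F.≟ t
  ... | yes _ | _     = refl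
  ... | no  _ | yes _ = refl
  ... | no ¬p | no ¬q = ⊥-elim ([ ¬p , ¬q ]′ h∋t)

  -- If every vertex is x or one of two vertices y h, z h attached to an
  -- edge h at x, then G has at most 1 + 2·deg(x) vertices: encode such a
  -- vertex by 0, or by h in the first or second copy of the edges.
  near-count : ∀ x (y z : E → V) →
    (∀ t → (t ≡ x) ⊎ (Σ E λ h → Inc h x × ((t ≡ y h) ⊎ (t ≡ z h)))) →
    n G ≤ suc (degree G x + degree G x)
  near-count x y z near =
    subst (_≤ suc (degree G x + degree G x)) (countB-true {P = λ _ → true} (λ _ → refl))
      (subst (countB {n G} (λ _ → true) ≤_) size
        (countB-inj (λ _ → true) Q code (λ t _ → Q-code t) (λ t t′ _ _ eq → code-injective eq)))
    where
    M : ℕ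
    M = m G
    code : V → Fin (suc (M + M))
    code t with near t
    ... | inj₁ _                 = fz
    ... | inj₂ (h , _ , inj₁ _)  = fs (h ↑ˡ M)
    ... | inj₂ (h , _ , inj₂ _)  = fs (M ↑ʳ h)

    decode-half : E ⊎ E → V
    decode-half (inj₁ h) = y h
    decode-half (inj₂ h) = z h

    decode : Fin (suc (M + M)) → V
    decode fz     = x
    decode (fs c) = decode-half (F.splitAt M c)

    decode-code : ∀ t → decode (code t) ≡ t
    decode-code t with near t
    ... | inj₁ refl                 = refl
    ... | inj₂ (h , _ , inj₁ refl)  = cong decode-half (FP.splitAt-↑ˡ M h M)
    ... | inj₂ (h , _ , inj₂ refl)  = cong decode-half (FP.splitAt-↑ʳ M M h)

    code-injective : ∀ {t t′} → code t ≡ code t′ → t ≡ t′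
    code-injective {t} {t′} eq = trans (sym (decode-code t)) (trans (cong decode eq) (decode-code t′))

    Q : Fin (suc (M + M)) → Bool
    Q fz     = true
    Q (fs c) = [ (λ h → incident? h x) , (λ h → incident? h x) ]′ (F.splitAt M c)

    Q-code : ∀ t → Q (code t) ≡ true
    Q-code t with near t
    ... | inj₁ _                   = refl
    ... | inj₂ (h , h∋x , inj₁ _)  = trans (cong [ _ , _ ]′ (FP.splitAt-↑ˡ M h M)) (incident?-complete h∋x)
    ... | inj₂ (h , h∋x , inj₂ _)  = trans (cong [ _ , _ ]′ (FP.splitAt-↑ʳ M M h)) (incident?-complete h∋x)

    size : countB Q ≡ suc (degree G x + degree G x)
    size = cong suc (trans (countB-+ M (λ c → Q (fs c)))
             (cong₂ _+_ (countB-ext (λ h → cong [ _ , _ ]′ (FP.splitAt-↑ˡ M h M)))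
                        (countB-ext (λ h → cong [ _ , _ ]′ (FP.splitAt-↑ʳ M M h)))))

  crossing : ∀ {S u v} (P : V → Set) → (∀ t → Dec (P t)) → Reach G S u v → P u → ¬ P v →
    Σ E λ j → S j ≡ true × (Σ V λ a → Σ V λ b → Joins G j a b × P a × ¬ P b)
  crossing P P? here                  Pu ¬Pv = contradiction Pu ¬Pv
  crossing P P? (step {w = t} j Sj j∋ rest) Pu ¬Pv with P? t
  ... | yes Pt = crossing P P? rest Pt ¬Pv
  ... | no ¬Pt = j , Sj , _ , _ , j∋ , Pu , ¬Pt

module Growth (G : Graph) (conn : Connected G) where
  open Basics G

  endpoints : List E → List V
  endpoints []       = []
  endpoints (x ∷ xs) = end₁ x ∷ end₂ x ∷ endpoints xs

  length-endpoints : ∀ L → length (endpoints L) ≡ length L + length L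
  length-endpoints []       = refl
  length-endpoints (x ∷ xs) = cong suc (trans (cong suc (length-endpoints xs)) (sym (ℕP.+-suc _ _)))

  uncovered : ∀ {v} L → v ∉ endpoints L → ∀ {e} → e ∈ L → ¬ Inc e v
  uncovered (x ∷ xs) v∉ (here refl) (inj₁ refl) = v∉ (here refl)
  uncovered (x ∷ xs) v∉ (here refl) (inj₂ refl) = v∉ (there (here refl))
  uncovered (x ∷ xs) v∉ (there e∈) e∋v          = uncovered xs (λ p → v∉ (there (there p))) e∈ e∋v

  exit-edge : ∀ L {y x} → Reach G (λ _ → true) y x →
    (Σ E λ e → e ∈ L × Inc e y) → (∀ {e} → e ∈ L → ¬ Inc e x) →
    Σ E λ f → f ∉ L × (Σ E λ e → e ∈ L × Share e f)
  exit-edge L here              (e , e∈L , e∋y) off = contradiction e∋y (off e∈L)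
  exit-edge L (step j _ j∋ walk) (e , e∈L , e∋y) off with j ∈? L
  ... | yes j∈L = exit-edge L walk (j , j∈L , joins-inc₂ j∋) off
  ... | no  j∉L = j , j∉L , e , e∈L , (_ , e∋y , joins-inc₁ j∋)

  grow : ∀ x xs → length (x ∷ xs) + length (x ∷ xs) < n G →
    Σ E λ f → f ∉ x ∷ xs × (Σ E λ e → e ∈ x ∷ xs × Share e f)
  grow x xs small with missed (endpoints (x ∷ xs)) (subst (_< n G) (sym (length-endpoints (x ∷ xs))) small)
  ... | v , v∉ = exit-edge (x ∷ xs) (proj₂ conn (end₁ x) v) (x , here refl , inj₁ refl) (uncovered (x ∷ xs) v∉)

module LocalBound (G : Graph) (k : ℕ) (w : Fin (m G) → ℤ) (w±1 : IsWeighing G w)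
                  (positive : LocalPositive G k w) (conn : Connected G) (large : k + k < n G) where
  open Basics G
  open Growth G conn

  w≤1 : ∀ e → w e ≤ℤ 1ℤ
  w≤1 e with w±1 e
  ... | inj₁ w≡1  rewrite w≡1  = ℤP.≤-refl
  ... | inj₂ w≡-1 rewrite w≡-1 = ℤ.-≤+

  short : ∀ {ℓ d} → ℓ + d ≡ k → ℓ + ℓ < n G
  short {ℓ} len = ℕP.≤-<-trans (ℕP.+-mono-≤ ℓ≤k ℓ≤k) large
    where
    ℓ≤k : ℓ ≤ k
    ℓ≤k = subst (ℓ ≤_) len (ℕP.m≤m+n _ _)

  -- A rooted list L of ℓ ≤ k distinct edges satisfies w(L) + (k - ℓ) > 0:
  -- grow L to a connected set of k edges, each new edge adding at most 1.
  local-bound : ∀ d x xs r → length (x ∷ xs) + d ≡ k → Unique (x ∷ xs) → Rooted (x ∷ xs) r →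
                0ℤ <ℤ listWeight w (x ∷ xs) +ℤ + d
  local-bound zero x xs r len uniq root =
    subst (0ℤ <ℤ_) (trans (weight-list w uniq) (sym (ℤP.+-identityʳ _)))
      (positive ⟦ x ∷ xs ⟧ (trans (count-list uniq) (trans (sym (ℕP.+-identityʳ _)) len))
                (rooted-connected root))
  local-bound (suc d) x xs r len uniq root with grow x xs (short {length (x ∷ xs)} len)
  ... | f , f∉ , e , e∈ , e~f = ℤP.<-≤-trans grown (ℤP.≤-trans add-f (ℤP.≤-reflexive regroup))
    where
    W : ℤ
    W = listWeight w (x ∷ xs)
    grown : 0ℤ <ℤ (w f +ℤ W) +ℤ + d
    grown = local-bound d f (x ∷ xs) r (trans (sym (ℕP.+-suc _ d)) len)
              (¬Any⇒All¬ (x ∷ xs) f∉ ∷ uniq) (rooted-grow root e∈ e~f)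
    add-f : (w f +ℤ W) +ℤ + d ≤ℤ (1ℤ +ℤ W) +ℤ + d
    add-f = ℤP.+-monoˡ-≤ (+ d) (ℤP.+-monoˡ-≤ W (w≤1 f))
    regroup : (1ℤ +ℤ W) +ℤ + d ≡ W +ℤ + suc d
    regroup = begin
      (1ℤ +ℤ W) +ℤ + d   ≡⟨ cong (_+ℤ + d) (ℤP.+-comm 1ℤ W) ⟩
      (W +ℤ 1ℤ) +ℤ + d   ≡⟨ ℤP.+-assoc W 1ℤ (+ d) ⟩
      W +ℤ + suc d       ∎
      where open ≡-Reasoning

  chain-bound : ∀ d x xs → length (x ∷ xs) + d ≡ k → Unique (x ∷ xs) → Chain (x ∷ xs) →
                listWeight w (x ∷ xs) +ℤ + d ≤ℤ 0ℤ → ⊥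
  chain-bound d x xs len uniq chain ≤0 =
    ℤP.<⇒≱ (local-bound d x xs (end₁ x) len uniq (chain-rooted x xs chain)) ≤0

  -- For k ≤ 2 every edge is positive (a single negative edge is a chain
  -- with w + (k - 1) ≤ 0).
  all-positive : (k ≡ 1) ⊎ (k ≡ 2) → ∀ e → w e ≡ 1ℤ
  all-positive k12 e with w±1 e
  ... | inj₁ w≡1  = w≡1
  ... | inj₂ w≡-1 = ⊥-elim (single k12)
    where
    single : (k ≡ 1) ⊎ (k ≡ 2) → ⊥
    single (inj₁ refl) = chain-bound 0 e [] refl ([] ∷ []) tt nonpositive
      where nonpositive : listWeight w (e ∷ []) +ℤ + 0 ≤ℤ 0ℤ
            nonpositive rewrite w≡-1 = ℤ.-≤+
    single (inj₂ refl) = chain-bound 1 e [] refl ([] ∷ []) tt nonpositive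
      where nonpositive : listWeight w (e ∷ []) +ℤ + 1 ≤ℤ 0ℤ
            nonpositive rewrite w≡-1 = ℤP.≤-refl

  module ThreeOrFour (k34 : (k ≡ 3) ⊎ (k ≡ 4)) where

    -- (F1) every neighbour of a negative edge is positive  (chain f e)
    neighbour-positive : ∀ {e f} → w e ≡ -1ℤ → f ≢ e → Share e f → w f ≡ 1ℤ
    neighbour-positive {e} {f} w≡-1 f≢e e~f with w±1 f
    ... | inj₁ wf≡1  = wf≡1
    ... | inj₂ wf≡-1 = ⊥-elim (pair k34)
      where
      uniq : Unique (f ∷ e ∷ [])
      uniq = (f≢e ∷ []) ∷ [] ∷ []
      pair : (k ≡ 3) ⊎ (k ≡ 4) → ⊥
      pair (inj₁ refl) = chain-bound 1 f (e ∷ []) refl uniq (share-sym e~f , tt) nonpositive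
        where nonpositive : listWeight w (f ∷ e ∷ []) +ℤ + 1 ≤ℤ 0ℤ
              nonpositive rewrite w≡-1 | wf≡-1 = ℤ.-≤+
      pair (inj₂ refl) = chain-bound 2 f (e ∷ []) refl uniq (share-sym e~f , tt) nonpositive
        where nonpositive : listWeight w (f ∷ e ∷ []) +ℤ + 2 ≤ℤ 0ℤ
              nonpositive rewrite w≡-1 | wf≡-1 = ℤP.≤-refl

    -- (F2) two distinct negative edges have no common neighbour  (chain e g f)
    no-common-neighbour : ∀ {e f g} → w e ≡ -1ℤ → w f ≡ -1ℤ → e ≢ f → g ≢ e → g ≢ f →
                          Share e g → Share g f → ⊥
    no-common-neighbour {e} {f} {g} we wf e≢f g≢e g≢f e~g g~f = triple k34
      where
      wg : w g ≡ 1ℤ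
      wg = neighbour-positive we g≢e e~g
      uniq : Unique (e ∷ g ∷ f ∷ [])
      uniq = ((λ e≡g → g≢e (sym e≡g)) ∷ e≢f ∷ []) ∷ (g≢f ∷ []) ∷ [] ∷ []
      triple : (k ≡ 3) ⊎ (k ≡ 4) → ⊥
      triple (inj₁ refl) = chain-bound 0 e (g ∷ f ∷ []) refl uniq (e~g , g~f , tt) nonpositive
        where nonpositive : listWeight w (e ∷ g ∷ f ∷ []) +ℤ + 0 ≤ℤ 0ℤ
              nonpositive rewrite we | wg | wf = ℤ.-≤+
      triple (inj₂ refl) = chain-bound 1 e (g ∷ f ∷ []) refl uniq (e~g , g~f , tt) nonpositive
        where nonpositive : listWeight w (e ∷ g ∷ f ∷ []) +ℤ + 1 ≤ℤ 0ℤ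
              nonpositive rewrite we | wg | wf = ℤP.≤-refl

    -- (F3) for k = 4: no path e g h f of distinct edges has negative ends
    no-negative-ends : k ≡ 4 → ∀ {e g h f} → w e ≡ -1ℤ → w f ≡ -1ℤ →
      Unique (e ∷ g ∷ h ∷ f ∷ []) → Chain (e ∷ g ∷ h ∷ f ∷ []) → ⊥
    no-negative-ends refl {e} {g} {h} {f} we wf uniq@((e≢g ∷ _) ∷ (_ ∷ _ ∷ []) ∷ (h≢f ∷ []) ∷ _)
                     chain@(e~g , g~h , h~f , _) =
      chain-bound 0 e (g ∷ h ∷ f ∷ []) refl uniq chain nonpositive
      where
      wg : w g ≡ 1ℤ
      wg = neighbour-positive we (λ g≡e → e≢g (sym g≡e)) e~g
      wh : w h ≡ 1ℤ
      wh = neighbour-positive wf h≢f (share-sym h~f)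
      nonpositive : listWeight w (e ∷ g ∷ h ∷ f ∷ []) +ℤ + 0 ≤ℤ 0ℤ
      nonpositive rewrite we | wg | wh | wf = ℤP.≤-refl

    signs-differ : ∀ {e f} → w e ≡ -1ℤ → w f ≡ 1ℤ → e ≢ f
    signs-differ we wf refl with trans (sym we) wf
    ... | ()

    isNeg⇒negative : ∀ e → isNeg (w e) ≡ true → w e ≡ -1ℤ
    isNeg⇒negative e p with w±1 e
    ... | inj₂ we = we
    ... | inj₁ we with trans (sym (cong isNeg we)) p
    ...   | ()

    1≤k : 1 ≤ k
    1≤k = positive-k k34
      where
      positive-k : (k ≡ 3) ⊎ (k ≡ 4) → 1 ≤ k
      positive-k (inj₁ refl) = s≤s z≤n
      positive-k (inj₂ refl) = s≤s z≤n

    -- Every edge has a neighbour, since G is connected with more than two vertices.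
    -- (opaque: only its specification matters, and unfolding it is costly)
    opaque
      some-neighbour : ∀ e → Σ E λ f → f ≢ e × Share e f
      some-neighbour e with grow e [] (short {1} {k ∸ 1} (ℕP.m+[n∸m]≡n 1≤k))
      ... | f , f∉ , _ , here refl , e~f = f , (λ f≡e → f∉ (here f≡e)) , e~f

    -- The pairing: each negative edge is matched with a fixed neighbour, its
    -- partner, which is positive by (F1); by (F2) distinct negative edges
    -- have distinct partners.
    partner : E → E
    partner e = proj₁ (some-neighbour e)

    partner-≢ : ∀ e → partner e ≢ e
    partner-≢ e = proj₁ (proj₂ (some-neighbour e))

    partner-share : ∀ e → Share e (partner e)
    partner-share e = proj₂ (proj₂ (some-neighbour e))

    partner-positive : ∀ {e} → w e ≡ -1ℤ → w (partner e) ≡ 1ℤ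
    partner-positive {e} we = neighbour-positive we (partner-≢ e) (partner-share e)

    partner-injective : ∀ {e f} → w e ≡ -1ℤ → w f ≡ -1ℤ → partner e ≡ partner f → e ≡ f
    partner-injective {e} {f} we wf same with e F.≟ f
    ... | yes e≡f = e≡f
    ... | no  e≢f = ⊥-elim (no-common-neighbour we wf e≢f (partner-≢ e)
                      (λ g≡f → partner-≢ f (trans (sym same) g≡f))
                      (partner-share e) (share-sym (subst (Share f) (sym same) (partner-share f))))

    partner-maps : ∀ e → isNeg (w e) ≡ true → isPos (w (partner e)) ≡ true
    partner-maps e n = cong isPos (partner-positive (isNeg⇒negative e n))

    partner-separates : ∀ e f → isNeg (w e) ≡ true → isNeg (w f) ≡ true → partner e ≡ partner f → e ≡ f
    partner-separates e f ne nf = partner-injective (isNeg⇒negative e ne) (isNeg⇒negative f nf)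

    total-nonnegative : 0ℤ ≤ℤ totalWeight G w
    total-nonnegative = subst (0ℤ ≤ℤ_) (sym (sum-signs w w±1))
      (⊖-nonnegative (countB-inj (λ e → isNeg (w e)) (λ e → isPos (w e)) partner
                        partner-maps partner-separates))

    total-positive : ∀ h → w h ≡ 1ℤ → (∀ e → w e ≡ -1ℤ → partner e ≢ h) → 0ℤ <ℤ totalWeight G w
    total-positive h wh missed = subst (0ℤ <ℤ_) (sym (sum-signs w w±1))
      (⊖-positive (countB-inj-strict (λ e → isNeg (w e)) (λ e → isPos (w e)) partner h
                     partner-maps partner-separates
                     (cong isPos wh) (λ e n → missed e (isNeg⇒negative e n))))

    Saturated : Set
    Saturated = ∀ h → w h ≡ 1ℤ → Σ E λ f → w f ≡ -1ℤ × partner f ≡ h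

    preimage? : ∀ h → Dec (Σ E λ f → w f ≡ -1ℤ × partner f ≡ h)
    preimage? h = FP.any? (λ f → (w f ℤP.≟ -1ℤ) ×-dec (partner f F.≟ h))

    positive-or-saturated : (0ℤ <ℤ totalWeight G w) ⊎ Saturated
    positive-or-saturated with FP.any? (λ h → (w h ℤP.≟ 1ℤ) ×-dec ¬? (preimage? h))
    ... | yes (h , wh , none) = inj₁ (total-positive h wh (λ e we same → none (e , we , same)))
    ... | no  all-hit         = inj₂ (λ h wh → decidable-stable (preimage? h) (λ none → all-hit (h , wh , none)))

    module Saturation (sat : Saturated) where

      only-neighbour : ∀ {e g} → w e ≡ -1ℤ → g ≢ e → Share e g → g ≡ partner e
      only-neighbour {e} {g} we g≢e e~g with sat g (neighbour-positive we g≢e e~g)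
      ... | f , wf , pf≡g with f F.≟ e
      ...   | yes refl = sym pf≡g
      ...   | no  f≢e  = ⊥-elim (no-common-neighbour we wf (λ e≡f → f≢e (sym e≡f)) g≢e
                           (≢-sym (signs-differ wf (neighbour-positive we g≢e e~g)))
                           e~g (share-sym (subst (Share f) pf≡g (partner-share f))))

      some-negative : E → Σ E λ e → w e ≡ -1ℤ
      some-negative e with w±1 e
      ... | inj₂ we = e , we
      ... | inj₁ we = proj₁ (sat e we) , proj₁ (proj₂ (sat e we))

      -- For k = 4 saturation is impossible: take a negative edge e with
      -- partner g and grow {g, e} by an edge f.  By uniqueness of neighbours
      -- f meets g, not e; a negative f contradicts (F2), and a positive f has
      -- a negative partner-preimage f′ giving the path e g f f′ forbidden by (F3).
      saturated-impossible-for-4 : k ≡ 4 → E → ⊥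
      saturated-impossible-for-4 refl e₀ with some-negative e₀
      ... | e , we with grow (partner e) (e ∷ []) (short {2} {2} refl)
      ... | f , f∉ , _ , there (here refl) , e~f =
        f∉ (here (only-neighbour we (λ f≡e → f∉ (there (here f≡e))) e~f))
      ... | f , f∉ , _ , here refl , g~f with w±1 f
      ...   | inj₂ wf = no-common-neighbour we wf (λ e≡f → f∉ (there (here (sym e≡f)))) (partner-≢ e)
                          (λ g≡f → f∉ (here (sym g≡f))) (partner-share e) g~f
      ...   | inj₁ wf with sat f wf
      ...     | f′ , wf′ , pf′≡f with f′ F.≟ e
      ...       | yes refl = f∉ (here (sym pf′≡f))
      ...       | no  f′≢e = no-negative-ends refl we wf′ uniq
                               (partner-share e , g~f , share-sym (subst (Share f′) pf′≡f (partner-share f′)) , tt)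
        where
        g : E
        g = partner e
        wg : w g ≡ 1ℤ
        wg = partner-positive we
        uniq : Unique (e ∷ g ∷ f ∷ f′ ∷ [])
        uniq = ( (λ e≡g → partner-≢ e (sym e≡g)) ∷ (λ e≡f → f∉ (there (here (sym e≡f))))
               ∷ (λ e≡f′ → f′≢e (sym e≡f′)) ∷ [])
             ∷ ((λ g≡f → f∉ (here (sym g≡f))) ∷ (λ g≡f′ → signs-differ wf′ wg (sym g≡f′)) ∷ [])
             ∷ ((λ f≡f′ → signs-differ wf′ wf (sym f≡f′)) ∷ [])
             ∷ [] ∷ []

      -- the negative edge whose partner is h (junk value h when h is negative)
      preimage : E → E
      preimage h with w±1 h
      ... | inj₁ wh = proj₁ (sat h wh)
      ... | inj₂ _  = h

      preimage-negative : ∀ {h} → w h ≡ 1ℤ → w (preimage h) ≡ -1ℤ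
      preimage-negative {h} wh with w±1 h
      ... | inj₁ wh′ = proj₁ (proj₂ (sat h wh′))
      ... | inj₂ wh′ with trans (sym wh) wh′
      ...   | ()

      partner-preimage : ∀ {h} → w h ≡ 1ℤ → partner (preimage h) ≡ h
      partner-preimage {h} wh with w±1 h
      ... | inj₁ wh′ = proj₂ (proj₂ (sat h wh′))
      ... | inj₂ wh′ with trans (sym wh) wh′
      ...   | ()

      -- Saturated G is a spider: fix a negative edge e, its partner g, and
      -- the endpoint x of g away from e.  Every edge h at x is positive, its
      -- preimage f_h hangs at the far end y_h of h, and nothing else is attached
      -- to y_h or to the far end z_h of f_h.  So every vertex is x, y_h or z_h.
      module Spider-shape (e : E) (we : w e ≡ -1ℤ) where
        g : E
        g = partner e

        v : V
        v = proj₁ (partner-share e)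

        e∋v : Inc e v
        e∋v = proj₁ (proj₂ (partner-share e))

        g∋v : Inc g v
        g∋v = proj₂ (proj₂ (partner-share e))

        x : V
        x = other g v

        g∋x : Inc g x
        g∋x = inc-other g∋v

        e∌x : ¬ Inc e x
        e∌x e∋x = partner-≢ e (sym (same-ends e∋v e∋x g∋v g∋x (λ v≡x → other-≢ g∋v (sym v≡x))))

        -- a negative edge at x would share the neighbour g with e, against (F2)
        no-negative-at-x : ∀ {h} → w h ≡ -1ℤ → ¬ Inc h x
        no-negative-at-x {h} wh h∋x =
          no-common-neighbour we wh (λ e≡h → e∌x (subst (λ a → Inc a x) (sym e≡h) h∋x)) (partner-≢ e)
            (λ g≡h → signs-differ wh (partner-positive we) (sym g≡h)) (partner-share e) (x , g∋x , h∋x)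

        at-x-positive : ∀ {h} → Inc h x → w h ≡ 1ℤ
        at-x-positive {h} h∋x with w±1 h
        ... | inj₁ wh = wh
        ... | inj₂ wh = ⊥-elim (no-negative-at-x wh h∋x)

        y z : E → V
        y h = other h x
        z h = other (preimage h) (y h)

        wf : ∀ {h} → Inc h x → w (preimage h) ≡ -1ℤ
        wf h∋x = preimage-negative (at-x-positive h∋x)

        f∋y : ∀ {h} → Inc h x → Inc (preimage h) (y h)
        f∋y {h} h∋x with subst (Share (preimage h)) (partner-preimage (at-x-positive h∋x)) (partner-share (preimage h))
        ... | s , f∋s , h∋s with inc-two h∋x h∋s
        ...   | inj₁ s≡x = ⊥-elim (no-negative-at-x (wf h∋x) (subst (Inc (preimage h)) s≡x f∋s))
        ...   | inj₂ s≡y = subst (Inc (preimage h)) s≡y f∋s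

        -- by uniqueness of neighbours of the negative edge f_h
        at-y : ∀ {h j} → Inc h x → Inc j (y h) → (j ≡ h) ⊎ (j ≡ preimage h)
        at-y {h} {j} h∋x j∋y with j F.≟ preimage h
        ... | yes j≡f = inj₂ j≡f
        ... | no  j≢f = inj₁ (trans (only-neighbour (wf h∋x) j≢f (y h , f∋y h∋x , j∋y))
                                    (partner-preimage (at-x-positive h∋x)))

        at-z : ∀ {h j} → Inc h x → Inc j (z h) → j ≡ preimage h
        at-z {h} {j} h∋x j∋z with j F.≟ preimage h
        ... | yes j≡f = j≡f
        ... | no  j≢f with trans (only-neighbour (wf h∋x) j≢f (z h , inc-other (f∋y h∋x) , j∋z))
                                 (partner-preimage (at-x-positive h∋x))
        ...   | refl with inc-two h∋x j∋z
        ...     | inj₁ z≡x = ⊥-elim (no-negative-at-x (wf h∋x) (subst (Inc (preimage h)) z≡x (inc-other (f∋y h∋x))))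
        ...     | inj₂ z≡y = ⊥-elim (other-≢ (f∋y h∋x) z≡y)

        -- the vertices x, y_h, z_h form a set closed under adjacency, hence all of G
        Near : V → Set
        Near t = (t ≡ x) ⊎ (Σ E λ h → Inc h x × ((t ≡ y h) ⊎ (t ≡ z h)))

        near-closed : ∀ {j t t′} → Near t → Joins G j t t′ → Near t′
        near-closed {j} (inj₁ refl) j∋ = inj₂ (j , joins-inc₁ j∋ , inj₁ (joins-other j∋))
        near-closed {j} (inj₂ (h , h∋x , inj₁ refl)) j∋ with at-y h∋x (joins-inc₁ j∋)
        ... | inj₁ refl = inj₁ (trans (joins-other j∋) (other-other h∋x))
        ... | inj₂ refl = inj₂ (h , h∋x , inj₂ (joins-other j∋))
        near-closed {j} (inj₂ (h , h∋x , inj₂ refl)) j∋ with at-z h∋x (joins-inc₁ j∋)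
        ... | refl = inj₂ (h , h∋x , inj₁ (trans (joins-other j∋) (other-other (f∋y h∋x))))

        all-near : ∀ t → Near t
        all-near t = walk (inj₁ refl) (proj₂ conn x t)
          where
          walk : ∀ {S a b} → Near a → Reach G S a b → Near b
          walk near here              = near
          walk near (step j _ j∋ rest) = walk (near-closed near j∋) rest

      saturated-small : E → ∀ Δ → MaxDegreeAtMost G Δ → n G ≤ suc (Δ + Δ)
      saturated-small e₀ Δ bounded =
        ℕP.≤-trans (near-count x y z all-near) (s≤s (ℕP.+-mono-≤ (bounded x) (bounded x)))
        where open Spider-shape (proj₁ (some-negative e₀)) (proj₂ (some-negative e₀))

-- Every vertex of a cycle has two distinct neighbours on the cycle; hence
-- a vertex whose neighbours on the cycle all coincide is not on it.
module Cycles (G : Graph) {l : ℕ} (c : Fin (3 + l) → Fin (n G)) (c-injective : ∀ {i j} → c i ≡ c j → i ≡ j)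
              (adjacent : ∀ (i : Fin (2 + l)) → Adj G (c (inject₁ i)) (c (fs i)))
              (closing : Adj G (c (fromℕ (2 + l))) (c fz)) where

  adj-sym : ∀ {u v} → Adj G u v → Adj G v u
  adj-sym (e , e∋) = e , Basics.joins-sym G e∋

  before : ∀ i → Σ (Fin (3 + l)) λ a → Adj G (c i) (c a) ×
                   ((suc (toℕ a) ≡ toℕ i) ⊎ ((toℕ i ≡ 0) × (toℕ a ≡ 2 + l)))
  before fz     = fromℕ (2 + l) , adj-sym closing , inj₂ (refl , FP.toℕ-fromℕ (2 + l))
  before (fs j) = inject₁ j , adj-sym (adjacent j) , inj₁ (cong suc (FP.toℕ-inject₁ j))

  after : ∀ i → Σ (Fin (3 + l)) λ b → Adj G (c i) (c b) ×
                  ((toℕ b ≡ suc (toℕ i)) ⊎ ((toℕ i ≡ 2 + l) × (toℕ b ≡ 0)))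
  after i with 2 + l ℕ.≟ toℕ i
  ... | yes last≡i = fz , subst (λ u → Adj G (c u) (c fz)) (FP.toℕ-injective (trans (FP.toℕ-fromℕ (2 + l)) last≡i)) closing
                   , inj₂ (sym last≡i , refl)
  ... | no  last≢i = fs (lower₁ i last≢i)
                   , subst (λ u → Adj G (c u) (c (fs (lower₁ i last≢i)))) (FP.inject₁-lower₁ i last≢i) (adjacent (lower₁ i last≢i))
                   , inj₁ (cong suc (FP.toℕ-lower₁ i last≢i))

  -- the two neighbours are at different positions, as the cycle has length ≥ 3
  before≢after : ∀ {a b i} → ((suc a ≡ i) ⊎ ((i ≡ 0) × (a ≡ 2 + l))) →
                 ((b ≡ suc i) ⊎ ((i ≡ 2 + l) × (b ≡ 0))) → a ≢ b
  before≢after (inj₁ refl)            (inj₁ refl)            a≡b = ℕP.m≢1+n+m _ {1} a≡b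
  before≢after (inj₁ refl)            (inj₂ (1+a≡2+l , refl)) refl with 1+a≡2+l
  ... | ()
  before≢after (inj₂ (refl , refl))   (inj₁ refl)            ()
  before≢after (inj₂ (refl , _))      (inj₂ (() , _))

  OnCycle : Fin (n G) → Set
  OnCycle u = Σ (Fin (3 + l)) λ i → c i ≡ u

  off-cycle : ∀ u → (∀ {a b} → Adj G u a → Adj G u b → OnCycle a → OnCycle b → a ≡ b) → ¬ OnCycle u
  off-cycle u unique-neighbour (i , refl) with before i | after i
  ... | a , u~a , pos-a | b , u~b , pos-b =
    before≢after pos-a pos-b (cong toℕ (c-injective (unique-neighbour u~a u~b (a , refl) (b , refl))))

-- The spider with t legs of length two: a centre joined to mid i, which is
-- joined to leaf i.  Weighing inner edges +1 and outer edges -1 is 3-local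
-- positive with total weight 0.
module Spider (t : ℕ) where
  V : Set
  V = Fin (suc (t + t))

  centre : V
  centre = fz

  mid leaf : Fin t → V
  mid i  = fs (i ↑ˡ t)
  leaf i = fs (t ↑ʳ i)

  inner outer : Fin t → Fin (t + t)
  inner i = i ↑ˡ t
  outer i = t ↑ʳ i

  mid-injective : ∀ {i j} → mid i ≡ mid j → i ≡ j
  mid-injective eq = FP.↑ˡ-injective t _ _ (FP.suc-injective eq)

  leaf-injective : ∀ {i j} → leaf i ≡ leaf j → i ≡ j
  leaf-injective eq = FP.↑ʳ-injective t _ _ (FP.suc-injective eq)

  inner≢outer : ∀ {i j} → inner i ≢ outer j
  inner≢outer {i} {j} eq with trans (sym (FP.splitAt-↑ˡ t i t)) (trans (cong (F.splitAt t) eq) (FP.splitAt-↑ʳ t t j))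
  ... | ()

  mid≢leaf : ∀ {i j} → mid i ≢ leaf j
  mid≢leaf eq = inner≢outer (FP.suc-injective eq)

  leg-ends : Fin t ⊎ Fin t → V × V
  leg-ends (inj₁ i) = centre , mid i
  leg-ends (inj₂ i) = mid i , leaf i

  leg-no-loop : ∀ s → proj₁ (leg-ends s) ≢ proj₂ (leg-ends s)
  leg-no-loop (inj₁ i) ()
  leg-no-loop (inj₂ i) eq = mid≢leaf eq

  leg-no-multi : ∀ s s′ → SameEnds (leg-ends s) (leg-ends s′) → s ≡ s′
  leg-no-multi (inj₁ i) (inj₁ j) (inj₁ (_ , eq)) = cong inj₁ (mid-injective eq)
  leg-no-multi (inj₁ i) (inj₁ j) (inj₂ (() , _))
  leg-no-multi (inj₁ i) (inj₂ j) (inj₁ (() , _))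
  leg-no-multi (inj₁ i) (inj₂ j) (inj₂ (() , _))
  leg-no-multi (inj₂ i) (inj₁ j) (inj₁ (() , _))
  leg-no-multi (inj₂ i) (inj₁ j) (inj₂ (_ , ()))
  leg-no-multi (inj₂ i) (inj₂ j) (inj₁ (eq , _)) = cong inj₂ (mid-injective eq)
  leg-no-multi (inj₂ i) (inj₂ j) (inj₂ (eq , _)) = ⊥-elim (mid≢leaf eq)

  spider : Graph
  spider = record
    { n = suc (t + t) ; m = t + t ; ends = λ c → leg-ends (F.splitAt t c)
    ; noLoop  = λ c → leg-no-loop (F.splitAt t c)
    ; noMulti = λ c c′ same → trans (sym (FP.join-splitAt t t c))
        (trans (cong (F.join t t) (leg-no-multi (F.splitAt t c) (F.splitAt t c′) same)) (FP.join-splitAt t t c′)) }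

  open Basics spider using (E; reach-trans; reach-sym; crossing; ⟦_⟧; ⟦⟧⇒∈; count-list)

  data EdgeView : E → Set where
    inner-edge : ∀ i → EdgeView (inner i)
    outer-edge : ∀ i → EdgeView (outer i)

  edge-view : ∀ c → EdgeView c
  edge-view c = subst EdgeView (FP.join-splitAt t t c) (from-sum (F.splitAt t c))
    where from-sum : (s : Fin t ⊎ Fin t) → EdgeView (F.join t t s)
          from-sum (inj₁ i) = inner-edge i
          from-sum (inj₂ i) = outer-edge i

  data VertexView : V → Set where
    centre-vertex : VertexView centre
    mid-vertex    : ∀ i → VertexView (mid i)
    leaf-vertex   : ∀ i → VertexView (leaf i)

  vertex-view : ∀ u → VertexView u
  vertex-view fz     = centre-vertex
  vertex-view (fs c) = subst (λ a → VertexView (fs a)) (FP.join-splitAt t t c) (from-sum (F.splitAt t c))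
    where from-sum : (s : Fin t ⊎ Fin t) → VertexView (fs (F.join t t s))
          from-sum (inj₁ i) = mid-vertex i
          from-sum (inj₂ i) = leaf-vertex i

  ends-inner : ∀ i → ends spider (inner i) ≡ (centre , mid i)
  ends-inner i = cong leg-ends (FP.splitAt-↑ˡ t i t)

  ends-outer : ∀ i → ends spider (outer i) ≡ (mid i , leaf i)
  ends-outer i = cong leg-ends (FP.splitAt-↑ʳ t t i)

  JoinsView : E → V → V → Set
  JoinsView c a b =
      (Σ (Fin t) λ i → (c ≡ inner i) × (((a ≡ centre) × (b ≡ mid i)) ⊎ ((a ≡ mid i) × (b ≡ centre))))
    ⊎ (Σ (Fin t) λ i → (c ≡ outer i) × (((a ≡ mid i) × (b ≡ leaf i)) ⊎ ((a ≡ leaf i) × (b ≡ mid i))))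

  joins-view : ∀ {c a b} → Joins spider c a b → JoinsView c a b
  joins-view {c} {a} {b} c∋ = by-view (edge-view c) c∋
    where
    by-view : ∀ {c} → EdgeView c → Joins spider c a b → JoinsView c a b
    by-view (inner-edge i) c∋ with subst (λ p → SameEnds p (a , b)) (ends-inner i) c∋
    ... | inj₁ (p , q) = inj₁ (i , refl , inj₁ (sym p , sym q))
    ... | inj₂ (p , q) = inj₁ (i , refl , inj₂ (sym q , sym p))
    by-view (outer-edge i) c∋ with subst (λ p → SameEnds p (a , b)) (ends-outer i) c∋
    ... | inj₁ (p , q) = inj₂ (i , refl , inj₁ (sym p , sym q))
    ... | inj₂ (p , q) = inj₂ (i , refl , inj₂ (sym q , sym p))

  joins-inner : ∀ i → Joins spider (inner i) (mid i) centre
  joins-inner i = subst (λ p → SameEnds p (mid i , centre)) (sym (ends-inner i)) (inj₂ (refl , refl))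

  joins-outer : ∀ i → Joins spider (outer i) (leaf i) (mid i)
  joins-outer i = subst (λ p → SameEnds p (leaf i , mid i)) (sym (ends-outer i)) (inj₂ (refl , refl))

  leaf-neighbour : ∀ {i a} → Adj spider (leaf i) a → a ≡ mid i
  leaf-neighbour (c , c∋) with joins-view c∋
  ... | inj₁ (_ , _ , inj₁ (() , _))
  ... | inj₁ (_ , _ , inj₂ (eq , _)) = ⊥-elim (mid≢leaf (sym eq))
  ... | inj₂ (_ , _ , inj₁ (eq , _)) = ⊥-elim (mid≢leaf (sym eq))
  ... | inj₂ (_ , _ , inj₂ (eq , a≡)) with leaf-injective eq
  ...   | refl = a≡

  mid-neighbour : ∀ {i a} → Adj spider (mid i) a → (a ≡ centre) ⊎ (a ≡ leaf i)
  mid-neighbour (c , c∋) with joins-view c∋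
  ... | inj₁ (_ , _ , inj₁ (() , _))
  ... | inj₁ (_ , _ , inj₂ (_ , a≡)) = inj₁ a≡
  ... | inj₂ (_ , _ , inj₂ (eq , _)) = ⊥-elim (mid≢leaf eq)
  ... | inj₂ (_ , _ , inj₁ (eq , a≡)) with mid-injective eq
  ...   | refl = inj₂ a≡

  centre-neighbour : ∀ {a} → Adj spider centre a → Σ (Fin t) λ j → a ≡ mid j
  centre-neighbour (c , c∋) with joins-view c∋
  ... | inj₁ (j , _ , inj₁ (_ , a≡)) = j , a≡
  ... | inj₁ (_ , _ , inj₂ (() , _))
  ... | inj₂ (_ , _ , inj₁ (() , _))
  ... | inj₂ (_ , _ , inj₂ (() , _))

  connected : Connected spider
  connected = s≤s z≤n , λ u v → reach-trans (to-centre u) (reach-sym (to-centre v))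
    where
    to-centre : ∀ u → Reach spider (λ _ → true) u centre
    to-centre u = by-view (vertex-view u)
      where
      by-view : ∀ {u} → VertexView u → Reach spider (λ _ → true) u centre
      by-view centre-vertex   = here
      by-view (mid-vertex i)  = step (inner i) refl (joins-inner i) here
      by-view (leaf-vertex i) = step (outer i) refl (joins-outer i) (by-view (mid-vertex i))

  -- no vertex lies on a cycle: a leaf has one neighbour, so leaves are off
  -- every cycle; then the only possible cycle-neighbour of a mid is the
  -- centre; and then the centre has no cycle-neighbour at all
  acyclic : ¬ HasCycle spider
  acyclic (l , c , c-injective , adjacent , closing) = vertex-off (vertex-view (c fz)) (fz , refl)
    where
    open Cycles spider c c-injective adjacent closing using (off-cycle; OnCycle)

    leaf-off : ∀ i → ¬ OnCycle (leaf i)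
    leaf-off i = off-cycle (leaf i) (λ i~a i~b _ _ → trans (leaf-neighbour i~a) (sym (leaf-neighbour i~b)))

    towards-centre : ∀ {i a} → Adj spider (mid i) a → OnCycle a → a ≡ centre
    towards-centre {i} i~a on with mid-neighbour i~a
    ... | inj₁ a≡centre = a≡centre
    ... | inj₂ refl     = ⊥-elim (leaf-off i on)

    mid-off : ∀ i → ¬ OnCycle (mid i)
    mid-off i = off-cycle (mid i) (λ i~a i~b on-a on-b → trans (towards-centre i~a on-a) (sym (towards-centre i~b on-b)))

    centre-off : ¬ OnCycle centre
    centre-off = off-cycle centre (λ c~a _ on-a _ → ⊥-elim (mid-neighbour-off c~a on-a))
      where
      mid-neighbour-off : ∀ {a} → Adj spider centre a → ¬ OnCycle a
      mid-neighbour-off c~a with centre-neighbour c~a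
      ... | j , refl = mid-off j

    vertex-off : ∀ {u} → VertexView u → ¬ OnCycle u
    vertex-off centre-vertex   = centre-off
    vertex-off (mid-vertex i)  = mid-off i
    vertex-off (leaf-vertex i) = leaf-off i

  tree : IsTree spider
  tree = connected , acyclic

  leg-weight : Fin t ⊎ Fin t → ℤ
  leg-weight (inj₁ _) = 1ℤ
  leg-weight (inj₂ _) = -1ℤ

  weight : E → ℤ
  weight c = leg-weight (F.splitAt t c)

  weight-inner : ∀ i → weight (inner i) ≡ 1ℤ
  weight-inner i = cong leg-weight (FP.splitAt-↑ˡ t i t)

  weight-outer : ∀ i → weight (outer i) ≡ -1ℤ
  weight-outer i = cong leg-weight (FP.splitAt-↑ʳ t t i)

  weighing : IsWeighing spider weight
  weighing c = by-view (edge-view c)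
    where
    by-view : ∀ {c} → EdgeView c → (weight c ≡ 1ℤ) ⊎ (weight c ≡ -1ℤ)
    by-view (inner-edge i) = inj₁ (weight-inner i)
    by-view (outer-edge i) = inj₂ (weight-outer i)

  total-zero : totalWeight spider weight ≡ 0ℤ
  total-zero = trans (sum-signs weight weighing) (trans (cong₂ _⊖_ positives negatives) (ℤP.n⊖n≡0 t))
    where
    positives : countB (λ c → isPos (weight c)) ≡ t
    positives = trans (countB-+ t (λ c → isPos (weight c)))
      (trans (cong₂ _+_ (countB-true (λ i → cong isPos (weight-inner i)))
                        (countB-false (λ i → cong isPos (weight-outer i))))
             (ℕP.+-identityʳ t))
    negatives : countB (λ c → isNeg (weight c)) ≡ t
    negatives = trans (countB-+ t (λ c → isNeg (weight c)))
      (cong₂ _+_ (countB-false (λ i → cong isNeg (weight-inner i)))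
                 (countB-true (λ i → cong isNeg (weight-outer i))))

  Leg : Fin t → V → Set
  Leg i u = (u ≡ mid i) ⊎ (u ≡ leaf i)

  leg? : ∀ i u → Dec (Leg i u)
  leg? i u = (u F.≟ mid i) ⊎-dec (u F.≟ leaf i)

  leaving-leg : ∀ {i c a b} → Joins spider c a b → Leg i a → ¬ Leg i b → c ≡ inner i
  leaving-leg c∋ in-leg out with joins-view c∋
  ... | inj₁ (_ , _ , inj₁ (refl , _)) with in-leg
  ...   | inj₁ ()
  ...   | inj₂ ()
  leaving-leg c∋ in-leg out | inj₁ (p , refl , inj₂ (refl , _)) with in-leg
  ...   | inj₁ eq = cong inner (mid-injective eq)
  ...   | inj₂ eq = ⊥-elim (mid≢leaf eq)
  leaving-leg c∋ in-leg out | inj₂ (p , refl , inj₁ (refl , refl)) with in-leg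
  ...   | inj₁ eq = ⊥-elim (out (inj₂ (cong leaf (mid-injective eq))))
  ...   | inj₂ eq = ⊥-elim (mid≢leaf eq)
  leaving-leg c∋ in-leg out | inj₂ (p , refl , inj₂ (refl , refl)) with in-leg
  ...   | inj₁ eq = ⊥-elim (mid≢leaf (sym eq))
  ...   | inj₂ eq = ⊥-elim (out (inj₁ (cong mid (leaf-injective eq))))

  -- a connected edge set containing outer i and outer j for i ≢ j also
  -- contains inner i and inner j, so it has at least four edges
  two-outer : ∀ S → ConnectedEdgeSet spider S → ∀ {i j} → i ≢ j →
              S (outer i) ≡ true → S (outer j) ≡ true → 4 ≤ countB S
  two-outer S S-connected {i} {j} i≢j Si Sj =
    subst (_≤ countB S) (count-list uniq)
      (countB-inj ⟦ L ⟧ S (λ c → c) (λ c c∈ → in-S c (⟦⟧⇒∈ L c∈)) (λ _ _ _ _ eq → eq))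
    where
    L : List E
    L = outer i ∷ outer j ∷ inner i ∷ inner j ∷ []
    inner-used : ∀ {p q} → p ≢ q → S (outer p) ≡ true → S (outer q) ≡ true → S (inner p) ≡ true
    inner-used {p} {q} p≢q Sp Sq
      with crossing (Leg p) (leg? p)
             (subst₂ (Reach spider S) (cong proj₁ (ends-outer p)) (cong proj₁ (ends-outer q))
               (S-connected (outer p) (outer q) Sp Sq))
             (inj₁ refl) [ (λ eq → p≢q (sym (mid-injective eq))) , mid≢leaf ]′
    ... | c , Sc , _ , _ , c∋ , in-leg , out rewrite leaving-leg c∋ in-leg out = Sc
    uniq : Unique L
    uniq = ((λ eq → i≢j (FP.↑ʳ-injective t i j eq)) ∷ ≢-sym inner≢outer ∷ ≢-sym inner≢outer ∷ [])
         ∷ (≢-sym inner≢outer ∷ ≢-sym inner≢outer ∷ [])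
         ∷ ((λ eq → i≢j (FP.↑ˡ-injective t i j eq)) ∷ [])
         ∷ [] ∷ []
    in-S : ∀ c → c ∈ L → S c ≡ true
    in-S c (here refl)                         = Si
    in-S c (there (here refl))                 = Sj
    in-S c (there (there (here refl)))         = inner-used i≢j Si Sj
    in-S c (there (there (there (here refl)))) = inner-used (≢-sym i≢j) Sj Si

  -- so a connected 3-edge set has at most one negative edge and weight ≥ 1
  local-positive : LocalPositive spider 3 weight
  local-positive S three S-connected with countB (λ c → S c ∧ isNeg (weight c)) ℕ.≤? 1
  ... | yes ≤1 = subst (0ℤ <ℤ_) (sym (restricted-sum S weight weighing))
                   (subst (λ s → 0ℤ <ℤ s ⊖ (X + X)) (sym three) (⊖-positive (s≤s (ℕP.+-mono-≤ ≤1 ≤1))))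
    where X = countB (λ c → S c ∧ isNeg (weight c))
  ... | no  >1 with two-witnesses (λ c → S c ∧ isNeg (weight c)) (ℕP.≰⇒> >1)
  ... | c₁ , c₂ , c₁≢c₂ , neg₁ , neg₂ = ⊥-elim (ℕP.<-irrefl (sym three) (two-negatives (edge-view c₁) (edge-view c₂) c₁≢c₂ neg₁ neg₂))
    where
    two-negatives : ∀ {c₁ c₂} → EdgeView c₁ → EdgeView c₂ → c₁ ≢ c₂ →
      S c₁ ∧ isNeg (weight c₁) ≡ true → S c₂ ∧ isNeg (weight c₂) ≡ true → 4 ≤ countB S
    two-negatives (inner-edge i) _ _ neg₁ _ rewrite weight-inner i | ∧-zeroʳ (S (inner i)) with neg₁
    ... | ()
    two-negatives (outer-edge i) (inner-edge j) _ _ neg₂ rewrite weight-inner j | ∧-zeroʳ (S (inner j)) with neg₂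
    ... | ()
    two-negatives (outer-edge i) (outer-edge j) c₁≢c₂ neg₁ neg₂ rewrite weight-outer i | weight-outer j =
      two-outer S S-connected (λ i≡j → c₁≢c₂ (cong outer i≡j)) (trans (sym (∧-identityʳ _)) neg₁) (trans (sym (∧-identityʳ _)) neg₂)

sum-ones : ∀ {m} (w : Fin m → ℤ) → (∀ e → w e ≡ 1ℤ) → sumℤ w ≡ + m
sum-ones {zero}  w ones = refl
sum-ones {suc m} w ones rewrite ones fz = cong (1ℤ +ℤ_) (sum-ones (λ i → w (fs i)) (λ i → ones (fs i)))

fin-nonempty : ∀ {m} → Fin m → 0 < m
fin-nonempty fz     = s≤s z≤n
fin-nonempty (fs _) = s≤s z≤n

an-edge : ∀ G → Connected G → 2 ≤ n G → Fin (m G)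
an-edge G (_ , conn) two≤n = first-edge (conn zero′ one′) zero′≢one′
  where
  zero′ one′ : Fin (n G)
  zero′ = F.fromℕ< {0} (ℕP.≤-trans (s≤s z≤n) two≤n)
  one′  = F.fromℕ< {1} two≤n
  zero′≢one′ : zero′ ≢ one′
  zero′≢one′ eq with trans (sym (FP.toℕ-fromℕ< {0} (ℕP.≤-trans (s≤s z≤n) two≤n)))
                          (trans (cong toℕ eq) (FP.toℕ-fromℕ< {1} two≤n))
  ... | ()
  first-edge : ∀ {S a b} → Reach G S a b → a ≢ b → Fin (m G)
  first-edge here           a≢b = ⊥-elim (a≢b refl)
  first-edge (step e _ _ _) _   = e

more-than-2k : ∀ {k N} → 2 + (k + k) ≤ N → k + k < N
more-than-2k size = ℕP.≤-trans (ℕP.n≤1+n _) size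

at-least-2 : ∀ {k N} → 2 + (k + k) ≤ N → 2 ≤ N
at-least-2 size = ℕP.≤-trans (ℕP.m≤m+n 2 _) size

ForcedOn : ℕ → Graph → Set
ForcedOn k G = ∀ w → IsWeighing G w → LocalPositive G k w → 0ℤ <ℤ totalWeight G w

-- k = 1, 2: every edge is positive, so w(G) = |E(G)| > 0
forcing-1-2 : ∀ k → (k ≡ 1) ⊎ (k ≡ 2) → Forcing 𝒯 k
forcing-1-2 k k12 = 2 + (k + k) , forced
  where
  forced : ∀ G → 𝒯 G → 2 + (k + k) ≤ n G → ForcedOn k G
  forced G (conn , _) size w w±1 pos =
    subst (0ℤ <ℤ_) (sym (sum-ones w (all-positive k12)))
      (ℤ.+<+ (fin-nonempty (an-edge G conn (at-least-2 {k} size))))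
    where open LocalBound G k w w±1 pos conn (more-than-2k {k} size)

-- k = 4: some positive edge is not a partner, since saturation is impossible
forcing-4 : Forcing 𝒯 4
forcing-4 = 10 , forced
  where
  forced : ∀ G → 𝒯 G → 10 ≤ n G → ForcedOn 4 G
  forced G (conn , _) size w w±1 pos =
    [ (λ total>0 → total>0)
    , (λ sat → ⊥-elim (Saturation.saturated-impossible-for-4 sat refl (an-edge G conn (at-least-2 {4} size)))) ]′
    positive-or-saturated
    where
    open LocalBound G 4 w w±1 pos conn (more-than-2k {4} size)
    open ThreeOrFour (inj₂ refl)

nonnegative-3 : WeakBound 𝒯 3 0ℤ
nonnegative-3 = 8 , λ G (conn , _) size w w±1 pos →
  LocalBound.ThreeOrFour.total-nonnegative G 3 w w±1 pos conn (more-than-2k {3} size) (inj₁ refl)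

-- k = 3 with degrees at most Δ: a saturated tree would have at most 1 + 2Δ vertices
forcing-3-bounded : ∀ Δ → Forcing 𝒯[ Δ ] 3
forcing-3-bounded Δ = 8 + (Δ + Δ) , forced
  where
  forced : ∀ G → 𝒯[ Δ ] G → 8 + (Δ + Δ) ≤ n G → ForcedOn 3 G
  forced G ((conn , _) , bounded) size w w±1 pos =
    [ (λ total>0 → total>0)
    , (λ sat → ⊥-elim (ℕP.<⇒≱ more-than-1+2Δ (Saturation.saturated-small sat edge Δ bounded))) ]′
    positive-or-saturated
    where
    size₃ : 2 + (3 + 3) ≤ n G
    size₃ = ℕP.≤-trans (ℕP.m≤m+n 8 _) size
    more-than-1+2Δ : suc (Δ + Δ) < n G
    more-than-1+2Δ = ℕP.≤-trans (ℕP.m≤n+m (2 + (Δ + Δ)) 6) size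
    open LocalBound G 3 w w±1 pos conn (more-than-2k {3} size₃)
    open ThreeOrFour (inj₁ refl)
    edge : Fin (m G)
    edge = an-edge G conn (at-least-2 {3} size₃)

zero-weight-trees : ∀ N → Σ Graph λ G → 𝒯 G × N ≤ n G ×
  Σ (Fin (m G) → ℤ) λ w → IsWeighing G w × LocalPositive G 3 w × totalWeight G w ≡ 0ℤ
zero-weight-trees N = spider , tree , ℕP.≤-trans (ℕP.m≤m+n N N) (ℕP.n≤1+n _) ,
                      weight , weighing , local-positive , total-zero
  where open Spider N

not-forcing-3 : ¬ Forcing 𝒯 3
not-forcing-3 (N , forced) with zero-weight-trees N
... | G , tree , size , w , w±1 , pos , total≡0 =
  ℤP.<-irrefl refl (subst (0ℤ <ℤ_) total≡0 (forced G tree size w w±1 pos))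

no-positive-bound-3 : ∀ C → 0ℤ <ℤ C → ¬ WeakBound 𝒯 3 C
no-positive-bound-3 C C>0 (N , bound) with zero-weight-trees N
... | G , tree , size , w , w±1 , pos , total≡0 =
  ℤP.<⇒≱ C>0 (subst (C ≤ℤ_) total≡0 (bound G tree size w w±1 pos))

lemma3p1 : Forcing 𝒯 1 × Forcing 𝒯 2 × Forcing 𝒯 4 ×
           WeaklyForcingWithValue 𝒯 3 0ℤ ×
           (∀ (Δ : ℕ) → 1 ≤ Δ → Forcing 𝒯[ Δ ] 3)
lemma3p1 = forcing-1-2 1 (inj₁ refl) , forcing-1-2 2 (inj₂ refl) , forcing-4 ,
           (not-forcing-3 , nonnegative-3 , no-positive-bound-3) ,
           (λ Δ _ → forcing-3-bounded Δ)
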